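{- Let $P$ be a finite poset with a unique minimum and a unique maximum, and dimension $d$. Let $h$ be a positive integer such that $h\geq 2d|P|^{2}$ and $h$ is divisible by $|P|$. Then the poset $\frac{[h]^{d}}{[h]^{d}}$ can be partitioned into copies of $P$.
   Context: $\frac{[h]^{d}}{[h]^{d}}$ denotes the poset which is the disjoint union of two copies $H_0,H_1$ of the grid $[h]^{d}$ (each with the pointwise order), where additionally every element of $H_1$ is larger than every element of $H_0$. A copy of $P$ in a poset $Q$ is a subset whose induced subposet is isomorphic to $P$; a partition into copies of $P$ is a family of pairwise disjoint copies covering all elements. The dimension of $P$ is its Dushnik–Miller dimension: the smallest $d$ such that there exist bijections $\pi_1,\dots,\pi_d:P\to[|P|]$ with $p\le_P q$ iff $\pi_i(p)\le\pi_i(q)$ for all $i$. -}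

module Defs where

open import Level using (0ℓ)
open import Data.Nat using (ℕ; _*_)
open import Data.Fin using (Fin; zero; suc) renaming (_≤_ to _≤F_)
open import Data.Vec using (Vec; lookup)
open import Data.Product using (Σ; ∃; ∃-syntax; _×_; _,_; uncurry)
open import Data.Sum using (_⊎_)
open import Function.Bundles using (_⇔_)
open import Function.Definitions using (Bijective)
open import Relation.Binary.Core using (Rel)
open import Relation.Binary.Structures using (IsPartialOrder)
open import Relation.Binary.PropositionalEquality using (_≡_)
open import Relation.Nullary using (¬_)

record FinPoset (n : ℕ) : Set₁ where
  field
    _≤_       : Rel (Fin n) 0ℓ
    isPartialOrder : IsPartialOrder _≡_ _≤_

HasMin : ∀ {n} → FinPoset n → Set
HasMin {n} P = ∃[ m ] ((x : Fin n) → FinPoset._≤_ P m x)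

HasMax : ∀ {n} → FinPoset n → Set
HasMax {n} P = ∃[ m ] ((x : Fin n) → FinPoset._≤_ P x m)

Realizer : ∀ {n} → FinPoset n → ℕ → Set
Realizer {n} P d =
  Σ (Fin d → Fin n → Fin n) λ π →
    ((i : Fin d) → Bijective _≡_ _≡_ (π i)) ×
    ((p q : Fin n) → FinPoset._≤_ P p q ⇔ ((i : Fin d) → π i p ≤F π i q))

HasDimension : ∀ {n} → FinPoset n → ℕ → Set
HasDimension P d = Realizer P d × ((d' : ℕ) → Realizer P d' → d Data.Nat.≤ d')

-- The poset [h]^d / [h]^d : elements (layer, point) with layer ∈ {0,1},
-- point ∈ [h]^d (represented as Fin h coordinates).
Stack : ℕ → ℕ → Set
Stack h d = Fin 2 × Vec (Fin h) d

_≤S_ : ∀ {h d} → Stack h d → Stack h d → Set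
_≤S_ {h} {d} (a , x) (b , y) =
  (a ≡ zero × b ≡ suc zero) ⊎
  (a ≡ b × ((i : Fin d) → lookup x i ≤F lookup y i))

-- A partition of Stack h d into copies of P: k order-embeddings
-- f_j : P → Stack h d (so each image is an induced copy of P, isomorphic
-- via f_j) such that (j , p) ↦ f_j p is a bijection, i.e. the images are
-- pairwise disjoint and cover everything.
PartitionIntoCopies : ∀ {n} → FinPoset n → ℕ → ℕ → Set
PartitionIntoCopies {n} P h d =
  ∃[ k ] Σ (Fin k → Fin n → Stack h d) λ f →
    ((j : Fin k) (p q : Fin n) → FinPoset._≤_ P p q ⇔ (f j p ≤S f j q)) ×
    Bijective _≡_ _≡_ (uncurry f)

module Submission where

open import Defs
open import Data.Nat using (ℕ; _*_; _≤_)
open import Data.Nat.Divisibility using (_∣_)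

open import Data.Nat using (zero; suc; _+_; _^_; _∸_; _<_; NonZero; >-nonZero; z≤n; s≤s; s≤s⁻¹)
open import Data.Nat.Properties
  using ( ≤-trans; ≤-reflexive; n≤1+n; m≤m+n; m≤m*n; 1+n≰n; +-identityʳ; *-zeroʳ
        ; +-monoˡ-≤; +-monoʳ-≤; *-monoˡ-≤; *-monoʳ-≤; ^-monoˡ-≤; ∸-monoʳ-≤
        ; +-cancelˡ-≤; +-cancelʳ-≤; *-cancelˡ-≤; +-cancelʳ-≡; m∸n+n≡m; m+n∸m≡n
        ; module ≤-Reasoning )
open import Data.Nat.DivMod using (_/_; _%_; m≡m%n+[m/n]*n; m%n<n; m/n*n≤m)
open import Data.Nat.Divisibility using (divides)
open import Data.Nat.Tactic.RingSolver using (solve-∀)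
open import Data.Fin using (Fin; zero; suc; toℕ; combine; inject≤; fromℕ<; punchIn; punchOut; splitAt; _≟_)
  renaming (_≤_ to _≤F_)
open import Data.Fin.Properties
  using ( any?; injective⇒≤; suc-injective; *↔×; +↔⊎
        ; punchIn-injective; punchInᵢ≢i; punchOut-injective; punchOut-punchIn; punchIn-punchOut
        ; punchOut-cong; punchOut-mono-≤; punchOut-cancel-≤
        ; toℕ<n; toℕ-injective; toℕ-inject≤; toℕ-combine; toℕ-fromℕ<; combine-injective; inject≤-injective )
  renaming (≤-refl to ≤F-refl)
open import Data.Vec using (Vec; []; _∷_; lookup; tabulate)
open import Data.Vec.Properties using (lookup∘tabulate; ∷-injective)
open import Data.Vec.Relation.Binary.Pointwise.Extensional using (ext; Pointwise-≡⇒≡)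
open import Data.Product using (Σ-syntax; ∃; _×_; _,_; proj₁; proj₂; uncurry)
open import Data.Product.Properties using (,-injective)
open import Data.Product.Function.NonDependent.Propositional using (_×-↔_)
open import Data.Sum using (_⊎_; inj₁; inj₂; [_,_]′)
open import Data.Unit using (⊤; tt)
open import Data.Empty using (⊥-elim)
open import Function using (_∘_; const)
open import Function.Bundles using (_↔_; Inverse; mk↔ₛ′; Injection; _⇔_; mk⇔; Equivalence)
open import Function.Construct.Composition using (_⇔-∘_)
open import Function.Construct.Symmetry using (⇔-sym)
open import Function.Definitions using (Injective; Bijective)
open import Function.Properties.Inverse using (↔-refl; ↔-sym; ↔-trans; ↔⇒↣)
open import Relation.Binary.PropositionalEquality
  using (_≡_; _≢_; refl; sym; trans; cong; cong₂; subst; subst₂; module ≡-Reasoning)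
open import Relation.Binary.Structures using (IsPartialOrder)
open import Relation.Nullary using (yes; no)

-- Write n = |P| = r + 1, let m be the least and M the greatest
-- element of P, and let π₀, …, π_{d-1} be a realizer. Removing one element x
-- from P and deleting the value of x from every π_i embeds P − x into the grid
-- [r]^d, and the first coordinate of this embedding is a bijection onto [r].
-- Hence translates of the pattern never overlap: cut the first axis of [h]
-- into blocks of length r; the first coordinate of a point fixes the block and
-- the element, and then the other coordinates fix the shift. So [h]^d holds
-- many disjoint copies of P − x, and for h = s·n ≥ 2dn² a counting estimate
-- gives room for K = s·h^(d-1) of them. Put K copies of P − M into the lower
-- grid H₀ and K copies of P − m into the upper grid H₁; since K·r + K = h^d,
-- exactly K points of each grid remain. Adding M on a spare point of H₁ to each
-- copy of P − M, and m on a spare point of H₀ to each copy of P − m, gives 2K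
-- copies of P; they are disjoint, and since 2K·n = 2h^d they cover everything.

injective⇒surjective : ∀ {N} (f : Fin N → Fin N) → Injective _≡_ _≡_ f →
                       ∀ y → ∃ λ x → f x ≡ y
injective⇒surjective {zero} f f-inj ()
injective⇒surjective {suc N} f f-inj y with any? (λ x → f x ≟ y)
... | yes hit = hit
... | no miss = ⊥-elim (1+n≰n (injective⇒≤ squeezed-injective))
  where
  avoids : ∀ x → y ≢ f x
  avoids x eq = miss (x , sym eq)
  -- If y is missed, deleting y from the codomain squeezes Fin (1 + N) into Fin N.
  squeezed : Fin (suc N) → Fin N
  squeezed x = punchOut (avoids x)
  squeezed-injective : Injective _≡_ _≡_ squeezed
  squeezed-injective eq = f-inj (punchOut-injective (avoids _) (avoids _) eq)

to-injective : ∀ {A B : Set} (e : A ↔ B) → Injective _≡_ _≡_ (Inverse.to e)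
to-injective e = Injection.injective (↔⇒↣ e)

from-injective : ∀ {A B : Set} (e : A ↔ B) → Injective _≡_ _≡_ (Inverse.from e)
from-injective e = to-injective (↔-sym e)

injection⇒bijection : ∀ {A B : Set} {a b} → A ↔ Fin a → B ↔ Fin b → a ≡ b →
                      (f : A → B) → Injective _≡_ _≡_ f → Bijective _≡_ _≡_ f
injection⇒bijection {a = a} A↔ B↔ refl f f-inj = f-inj , onto
  where
  module α = Inverse A↔
  module β = Inverse B↔
  f̂ : Fin a → Fin a
  f̂ = β.to ∘ f ∘ α.from
  onto : ∀ y → ∃ λ x → ∀ {z} → z ≡ x → f z ≡ y
  onto y with x , f̂x≡y ← injective⇒surjective f̂ (from-injective A↔ ∘ f-inj ∘ to-injective B↔) (β.to y)
    = α.from x , λ { refl → to-injective B↔ f̂x≡y }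

Complement : ∀ a b → (Fin a → Fin (a + b)) → Set
Complement a b g = Σ[ ℓ ∈ (Fin b → Fin (a + b)) ] Injective _≡_ _≡_ ℓ × (∀ i k → ℓ i ≢ g k)

-- Every injection g : Fin a → Fin (a + b) has a complement: remove the value
-- g zero from the codomain, complement the remaining values, and put g zero back.
complement : ∀ a b (g : Fin a → Fin (a + b)) → Injective _≡_ _≡_ g → Complement a b g
complement zero b g g-inj = (λ i → i) , (λ eq → eq) , λ i ()
complement (suc a) b g g-inj = ℓ , ℓ-inj , disjoint
  where
  avoids : ∀ k → g zero ≢ g (suc k)
  avoids k eq with () ← g-inj eq
  g′ : Fin a → Fin (a + b)
  g′ k = punchOut (avoids k)
  g′-inj : Injective _≡_ _≡_ g′
  g′-inj eq = suc-injective (g-inj (punchOut-injective (avoids _) (avoids _) eq))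
  rest : Complement a b g′
  rest = complement a b g′ g′-inj
  ℓ′ : Fin b → Fin (a + b)
  ℓ′ = proj₁ rest
  ℓ : Fin b → Fin (suc a + b)
  ℓ i = punchIn (g zero) (ℓ′ i)
  ℓ-inj : Injective _≡_ _≡_ ℓ
  ℓ-inj eq = proj₁ (proj₂ rest) (punchIn-injective (g zero) _ _ eq)
  disjoint : ∀ i k → ℓ i ≢ g k
  disjoint i zero eq = punchInᵢ≢i (g zero) (ℓ′ i) eq
  disjoint i (suc k) eq = proj₂ (proj₂ rest) i k
    (trans (sym (punchOut-punchIn (g zero))) (punchOut-cong (g zero) eq))

extend-injection : ∀ {A B : Set} {a b} → A ↔ Fin a → B ↔ Fin (a + b) →
                   (g : A → B) → Injective _≡_ _≡_ g →
                   Σ[ ℓ ∈ (Fin b → B) ] Injective _≡_ _≡_ [ g , ℓ ]′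
extend-injection {A} {B} {a} {b} A↔ B↔ g g-inj = ℓ , extended-injective
  where
  module α = Inverse A↔
  module β = Inverse B↔
  ĝ : Fin a → Fin (a + b)
  ĝ = β.to ∘ g ∘ α.from
  rest : Complement a b ĝ
  rest = complement a b ĝ (from-injective A↔ ∘ g-inj ∘ to-injective B↔)
  ℓ̂ : Fin b → Fin (a + b)
  ℓ̂ = proj₁ rest
  ℓ : Fin b → B
  ℓ = β.from ∘ ℓ̂
  avoids : ∀ i x → ℓ i ≢ g x
  avoids i x eq = proj₂ (proj₂ rest) i (α.to x) (begin
    ℓ̂ i                  ≡⟨ β.strictlyInverseˡ (ℓ̂ i) ⟨
    β.to (ℓ i)           ≡⟨ cong β.to eq ⟩
    β.to (g x)           ≡⟨ cong (β.to ∘ g) (α.strictlyInverseʳ x) ⟨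
    ĝ (α.to x)           ∎)
    where open ≡-Reasoning
  extended-injective : Injective _≡_ _≡_ [ g , ℓ ]′
  extended-injective {inj₁ x} {inj₁ y} eq = cong inj₁ (g-inj eq)
  extended-injective {inj₁ x} {inj₂ j} eq = ⊥-elim (avoids j x (sym eq))
  extended-injective {inj₂ i} {inj₁ y} eq = ⊥-elim (avoids i y eq)
  extended-injective {inj₂ i} {inj₂ j} eq =
    cong inj₂ (proj₁ (proj₂ rest) (from-injective B↔ eq))

grid↔ : ∀ h d → Vec (Fin h) d ↔ Fin (h ^ d)
grid↔ h zero = mk↔ₛ′ (λ _ → zero) (λ _ → []) (λ { zero → refl }) (λ { [] → refl })
grid↔ h (suc d) = ↔-trans uncons (↔-trans (↔-refl ×-↔ grid↔ h d) (↔-sym *↔×))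
  where
  uncons : Vec (Fin h) (suc d) ↔ (Fin h × Vec (Fin h) d)
  uncons = mk↔ₛ′ (λ { (x ∷ xs) → x , xs }) (λ (x , xs) → x ∷ xs)
                 (λ _ → refl) (λ { (x ∷ xs) → refl })

stack↔ : ∀ h d → Stack h d ↔ Fin (2 * h ^ d)
stack↔ h d = ↔-trans (↔-refl ×-↔ grid↔ h d) (↔-sym *↔×)

retraction⇒injective : ∀ {A B : Set} (f : A → B) (g : B → A) → (∀ x → g (f x) ≡ x) → Injective _≡_ _≡_ f
retraction⇒injective f g gf {x} {y} eq = trans (sym (gf x)) (trans (cong g eq) (gf y))

locate : ∀ {r} → Fin (suc r) → Fin (suc r) → ⊤ ⊎ Fin r
locate x p with x ≟ p
... | yes _ = inj₁ tt
... | no x≢p = inj₂ (punchOut x≢p)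

unlocate : ∀ {r} → Fin (suc r) → ⊤ ⊎ Fin r → Fin (suc r)
unlocate x = [ const x , punchIn x ]′

unlocate-locate : ∀ {r} (x p : Fin (suc r)) → unlocate x (locate x p) ≡ p
unlocate-locate x p with x ≟ p
... | yes x≡p = x≡p
... | no x≢p = punchIn-punchOut x≢p

relocate-order : ∀ {r} {_≤_ : Fin (suc r) → Fin (suc r) → Set} {R : ⊤ ⊎ Fin r → ⊤ ⊎ Fin r → Set} x →
                 (∀ z z′ → unlocate x z ≤ unlocate x z′ ⇔ R z z′) →
                 ∀ p q → p ≤ q ⇔ R (locate x p) (locate x q)
relocate-order {_≤_ = _≤_} {R} x order p q =
  subst₂ (λ a b → a ≤ b ⇔ R (locate x p) (locate x q))
         (unlocate-locate x p) (unlocate-locate x q) (order (locate x p) (locate x q))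

power-gap : ∀ w a E → (w + a) ^ suc E ≤ (w + a) * w ^ E + E * a * (w + a) ^ E
power-gap w a zero = ≤-reflexive (sym (+-identityʳ _))
power-gap w a (suc E) = begin
    H * H ^ suc E                          ≤⟨ *-monoʳ-≤ H (power-gap w a E) ⟩
    H * (H * Y + E * a * X)                ≡⟨ expand w a Y X E ⟩
    H * (w * Y) + a * (H * Y) + E * a * (H * X) ≤⟨ +-monoˡ-≤ (E * a * (H * X)) (+-monoʳ-≤ (H * (w * Y)) (*-monoʳ-≤ a HY≤HX)) ⟩
    H * (w * Y) + a * (H * X) + E * a * (H * X) ≡⟨ collect (H * (w * Y)) a (H * X) E ⟩
    H * (w * Y) + suc E * a * (H * X)      ∎
  where
  open ≤-Reasoning
  H X Y : ℕ
  H = w + a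
  X = H ^ E
  Y = w ^ E
  HY≤HX : H * Y ≤ H * X
  HY≤HX = *-monoʳ-≤ H (^-monoˡ-≤ E (m≤m+n w a))
  expand : ∀ w a Y X E → (w + a) * ((w + a) * Y + E * a * X) ≡ (w + a) * (w * Y) + a * ((w + a) * Y) + E * a * ((w + a) * X)
  expand = solve-∀
  collect : ∀ p a Z E → p + a * Z + E * a * Z ≡ p + (1 + E) * a * Z
  collect = solve-∀

-- Shrinking each side of the cube [h]^d by a, where n·d·a ≤ h, loses at most a
-- 1/n fraction of its volume: (n - 1)·h^d ≤ n·(h - a)^d.
volume-deficit : ∀ r d {h} w a → .{{NonZero h}} → w + a ≡ h → suc r * d * a ≤ h →
                 r * h ^ d ≤ suc r * w ^ d
volume-deficit r d w a refl nda≤h = *-cancelˡ-≤ H (+-cancelʳ-≤ (H * X) _ _ (begin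
    H * (r * X) + H * X          ≡⟨ split-n r H X ⟩
    suc r * (H * X)              ≤⟨ *-monoʳ-≤ (suc r) (power-gap w a d) ⟩
    suc r * (H * W + d * a * X)  ≡⟨ distribute r H W d a X ⟩
    H * (suc r * W) + suc r * d * a * X ≤⟨ +-monoʳ-≤ (H * (suc r * W)) (*-monoˡ-≤ X nda≤h) ⟩
    H * (suc r * W) + H * X      ∎))
  where
  open ≤-Reasoning
  H X W : ℕ
  H = w + a
  X = H ^ d
  W = w ^ d
  split-n : ∀ r H X → H * (r * X) + H * X ≡ (1 + r) * (H * X)
  split-n = solve-∀
  distribute : ∀ r H W d a X → (1 + r) * (H * W + d * a * X) ≡ H * ((1 + r) * W) + (1 + r) * d * a * X
  distribute = solve-∀

-- The room available in [h]^(e+1) for the s·h^e pairwise disjoint copies of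
-- P minus a point (|P| = n = r₀ + 2, h = s·n ≥ 2(e+1)n²): the first coordinate
-- is cut into ⌊h/r⌋ blocks of length r = n - 1, every other coordinate offers
-- h - r₀ shifts of an interval of length r.
module Room (r₀ e s h : ℕ) (h≡sn : h ≡ s * suc (suc r₀))
            (big : 2 * suc e * (suc (suc r₀) * suc (suc r₀)) ≤ h) where
  r n d : ℕ
  r = suc r₀
  n = suc r
  d = suc e

  blocks width copies : ℕ
  blocks = h / r
  width = h ∸ r₀
  copies = s * h ^ e

  blocks-fit : blocks * r ≤ h
  blocks-fit = m/n*n≤m h r

  n≤h : n ≤ h
  n≤h = ≤-trans (m≤m*n n (2 * d * n)) (≤-trans (≤-reflexive (rearrange n d)) big)
    where
    rearrange : ∀ n d → n * (2 * d * n) ≡ 2 * d * (n * n)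
    rearrange = solve-∀

  shifts-fit : width + r₀ ≡ h
  shifts-fit = m∸n+n≡m (≤-trans (n≤1+n r₀) (≤-trans (n≤1+n r) n≤h))

  instance
    h-nonZero : NonZero h
    h-nonZero = >-nonZero (≤-trans (s≤s z≤n) n≤h)

  layer-size : copies * r + copies ≡ h ^ d
  layer-size = begin
    s * h ^ e * r + s * h ^ e  ≡⟨ regroup s (h ^ e) r ⟩
    s * suc r * h ^ e          ≡⟨ cong (_* h ^ e) h≡sn ⟨
    h * h ^ e                  ∎
    where
    open ≡-Reasoning
    regroup : ∀ s X r → s * X * r + s * X ≡ s * (1 + r) * X
    regroup = solve-∀

  enough-room : copies ≤ blocks * width ^ e
  enough-room = *-cancelˡ-≤ (r * n) (begin
    r * n * copies                   ≡⟨ regroup r n s (h ^ e) ⟩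
    r * (s * n * h ^ e)              ≡⟨ cong (λ x → r * (x * h ^ e)) h≡sn ⟨
    r * h ^ d                        ≤⟨ volume-deficit r d width r₀ shifts-fit gap-small ⟩
    n * (width * width ^ e)          ≤⟨ *-monoʳ-≤ n (*-monoˡ-≤ (width ^ e) width≤blocks) ⟩
    n * (blocks * r * width ^ e)     ≡⟨ reorder n blocks r (width ^ e) ⟩
    r * n * (blocks * width ^ e)     ∎)
    where
    open ≤-Reasoning
    regroup : ∀ r n s X → r * n * (s * X) ≡ r * (s * n * X)
    regroup = solve-∀
    reorder : ∀ n b r W → n * (b * r * W) ≡ r * n * (b * W)
    reorder = solve-∀
    gap-small : n * d * r₀ ≤ h
    gap-small = begin
      n * d * r₀             ≤⟨ *-monoʳ-≤ (n * d) (≤-trans (n≤1+n r₀) (n≤1+n r)) ⟩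
      n * d * n              ≤⟨ m≤m+n (n * d * n) (n * d * n) ⟩
      n * d * n + n * d * n  ≡⟨ double n d ⟩
      2 * d * (n * n)        ≤⟨ big ⟩
      h                      ∎
      where
      double : ∀ n d → n * d * n + n * d * n ≡ 2 * d * (n * n)
      double = solve-∀
    -- the shifted intervals end before the last, possibly incomplete, block
    width≤blocks : width ≤ blocks * r
    width≤blocks = begin
      h ∸ r₀                 ≤⟨ ∸-monoʳ-≤ h (s≤s⁻¹ (m%n<n h r)) ⟩
      h ∸ h % r              ≡⟨ cong (_∸ h % r) (m≡m%n+[m/n]*n h r) ⟩
      h % r + blocks * r ∸ h % r ≡⟨ m+n∸m≡n (h % r) (blocks * r) ⟩
      blocks * r             ∎

_≤G_ : ∀ {h d} → Vec (Fin h) d → Vec (Fin h) d → Set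
_≤G_ {d = d} x y = (i : Fin d) → lookup x i ≤F lookup y i

-- Packing translates of a box [r]^(e+1) into [h]^(e+1): the first coordinate
-- of [h] is cut into `blocks` consecutive intervals of length r, and in every
-- other coordinate the box may start at any of `width` positions.
module Packing (r₀ h e blocks width : ℕ)
               (blocks-fit : blocks * suc r₀ ≤ h) (shifts-fit : width + r₀ ≡ h) where
  r : ℕ
  r = suc r₀

  Offset : Set
  Offset = Fin blocks × Vec (Fin width) e

  offset↔ : Offset ↔ Fin (blocks * width ^ e)
  offset↔ = ↔-trans (↔-refl ×-↔ grid↔ width e) (↔-sym *↔×)

  start : Offset → Fin (suc e) → ℕ
  start (t , ts) zero = r * toℕ t
  start (t , ts) (suc i) = toℕ (lookup ts i)

  shift-fits : (t : Fin width) (u : Fin r) → toℕ t + toℕ u < h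
  shift-fits t u = ≤-trans (+-monoˡ-≤ (toℕ u) (toℕ<n t))
                   (≤-trans (+-monoʳ-≤ width (s≤s⁻¹ (toℕ<n u))) (≤-reflexive shifts-fit))

  tile : Offset → (Fin (suc e) → Fin r) → Vec (Fin h) (suc e)
  tile (t , ts) v = inject≤ (combine t (v zero)) blocks-fit
                  ∷ tabulate (λ i → fromℕ< (shift-fits (lookup ts i) (v (suc i))))

  tile-coordinate : ∀ o v i → toℕ (lookup (tile o v) i) ≡ start o i + toℕ (v i)
  tile-coordinate (t , ts) v zero = trans (toℕ-inject≤ _ blocks-fit) (toℕ-combine t (v zero))
  tile-coordinate (t , ts) v (suc i) = trans (cong toℕ (lookup∘tabulate _ i)) (toℕ-fromℕ< _)

  tile-order : ∀ o v v′ → tile o v ≤G tile o v′ ⇔ (∀ i → v i ≤F v′ i)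
  tile-order o v v′ = mk⇔
    (λ le i → +-cancelˡ-≤ (start o i) _ _
      (subst₂ _≤_ (tile-coordinate o v i) (tile-coordinate o v′ i) (le i)))
    (λ le i → subst₂ _≤_ (sym (tile-coordinate o v i)) (sym (tile-coordinate o v′ i))
      (+-monoʳ-≤ (start o i) (le i)))

  -- If the first coordinate tells the points of a pattern apart, then distinct
  -- translates of the pattern are disjoint: the first coordinate determines the
  -- block and the point, and then each other coordinate determines its shift.
  tile-injective : ∀ {A : Set} (v : A → Fin (suc e) → Fin r) →
                   Injective _≡_ _≡_ (λ a → v a zero) →
                   Injective _≡_ _≡_ (λ ((o , a) : Offset × A) → tile o (v a))
  tile-injective v v-inj {(t , ts) , a} {(t′ , ts′) , a′} eq
    with refl , same-first ← combine-injective t (v a zero) t′ (v a′ zero)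
                               (inject≤-injective _ _ _ _ (proj₁ (∷-injective eq)))
    with refl ← v-inj same-first
    = cong (λ ts → (t , ts) , a) (Pointwise-≡⇒≡ (ext λ i →
        toℕ-injective (+-cancelʳ-≡ (toℕ (v a (suc i))) _ _ (begin
          toℕ (lookup ts i) + toℕ (v a (suc i))    ≡⟨ tile-coordinate (t , ts) (v a) (suc i) ⟨
          toℕ (lookup (tile (t , ts) (v a)) (suc i)) ≡⟨ cong (λ x → toℕ (lookup x (suc i))) eq ⟩
          toℕ (lookup (tile (t , ts′) (v a)) (suc i)) ≡⟨ tile-coordinate (t , ts′) (v a) (suc i) ⟩
          toℕ (lookup ts′ i) + toℕ (v a (suc i))   ∎))))
    where open ≡-Reasoning

  Translates : ℕ → (Fin r → Fin (suc e) → Fin r) → Set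
  Translates K v = Σ[ embed ∈ (Fin K × Fin r → Vec (Fin h) (suc e)) ]
    Injective _≡_ _≡_ embed ×
    (∀ j u u′ → embed (j , u) ≤G embed (j , u′) ⇔ (∀ i → v u i ≤F v u′ i))

  pack : ∀ {K} → K ≤ blocks * width ^ e →
         (v : Fin r → Fin (suc e) → Fin r) → Injective _≡_ _≡_ (λ u → v u zero) →
         Translates K v
  pack {K} K≤ v v-inj = embed , embed-injective , λ j u u′ → tile-order (offset j) (v u) (v u′)
    where
    offset : Fin K → Offset
    offset j = Inverse.from offset↔ (inject≤ j K≤)
    embed : Fin K × Fin r → Vec (Fin h) (suc e)
    embed (j , u) = tile (offset j) (v u)
    embed-injective : Injective _≡_ _≡_ embed
    embed-injective eq with same-offset , same-point ← ,-injective (tile-injective v v-inj eq)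
      = cong₂ _,_ (inject≤-injective _ _ _ _ (from-injective offset↔ same-offset)) same-point

-- A realizer with no linear orders makes every pair of elements comparable both
-- ways, so a poset of dimension 0 has at most one element.
zero-dimensional-trivial : ∀ {n} (P : FinPoset n) → Realizer P 0 → (p q : Fin n) → p ≡ q
zero-dimensional-trivial P (_ , _ , π-order) p q =
  IsPartialOrder.antisym (FinPoset.isPartialOrder P)
    (Equivalence.from (π-order p q) (λ ())) (Equivalence.from (π-order q p) (λ ()))

-- Deleting a point x from a poset P with a realizer of size d: each linear order
-- π i with the value π i x removed embeds P − x = {punchIn x u | u} into [n-1]^d.
module Deletion {r d} (P : FinPoset (suc r)) (π : Fin d → Fin (suc r) → Fin (suc r))
                (π-bijective : ∀ i → Bijective _≡_ _≡_ (π i))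
                (π-order : ∀ p q → FinPoset._≤_ P p q ⇔ ((i : Fin d) → π i p ≤F π i q))
                (x : Fin (suc r)) where
  open FinPoset P renaming (_≤_ to _≤P_)

  separates : ∀ i u → π i x ≢ π i (punchIn x u)
  separates i u eq = punchInᵢ≢i x u (sym (proj₁ (π-bijective i) eq))

  deleted : Fin r → Fin d → Fin r
  deleted u i = punchOut (separates i u)

  deleted-order : ∀ u u′ → punchIn x u ≤P punchIn x u′ ⇔ (∀ i → deleted u i ≤F deleted u′ i)
  deleted-order u u′ = mk⇔
    (λ le i → punchOut-mono-≤ (separates i u) (separates i u′) (to le i))
    (λ le → from λ i → punchOut-cancel-≤ (separates i u) (separates i u′) (le i))
    where open Equivalence (π-order (punchIn x u) (punchIn x u′))

  deleted-transversal : ∀ i → Injective _≡_ _≡_ (λ u → deleted u i)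
  deleted-transversal i eq =
    punchIn-injective x _ _ (proj₁ (π-bijective i) (punchOut-injective (separates i _) (separates i _) eq))

record DeletedCopies {r} (P : FinPoset (suc r)) (x : Fin (suc r)) (K h d : ℕ) : Set where
  field
    embed : Fin K × Fin r → Vec (Fin h) d
    embed-injective : Injective _≡_ _≡_ embed
    embed-order : ∀ j u u′ → FinPoset._≤_ P (punchIn x u) (punchIn x u′) ⇔ embed (j , u) ≤G embed (j , u′)

deleted-copies : ∀ {r₀ e h blocks width K} (P : FinPoset (suc (suc r₀))) →
                 Realizer P (suc e) → (x : Fin (suc (suc r₀))) →
                 blocks * suc r₀ ≤ h → width + r₀ ≡ h → K ≤ blocks * width ^ e →
                 DeletedCopies P x K h (suc e)
deleted-copies {r₀} {e} {h} {blocks} {width} {K} P (π , π-bijective , π-order) x blocks-fit shifts-fit K≤ = record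
  { embed = proj₁ packed
  ; embed-injective = proj₁ (proj₂ packed)
  ; embed-order = λ j u u′ → ⇔-sym (proj₂ (proj₂ packed) j u u′) ⇔-∘ deleted-order u u′
  }
  where
  open Deletion P π π-bijective π-order x
  open Packing r₀ h e blocks width blocks-fit shifts-fit
  packed : Translates K deleted
  packed = pack K≤ deleted (deleted-transversal zero)

no-deletions : ∀ {P : FinPoset 1} {x K h d} → DeletedCopies P x K h d
no-deletions = record { embed = λ { (_ , ()) } ; embed-injective = λ { {_ , ()} } ; embed-order = λ _ () }

-- The K grid points of layer 0 missed by the
-- copies of P − M receive the minima of the upper copies, and symmetrically.
module Assembly {r K h d} (P : FinPoset (suc r)) (m M : Fin (suc r))
                (m-least : ∀ p → FinPoset._≤_ P m p) (M-greatest : ∀ p → FinPoset._≤_ P p M)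
                (layer-size : K * r + K ≡ h ^ d)
                (lower : DeletedCopies P M K h d) (upper : DeletedCopies P m K h d) where
  open FinPoset P renaming (_≤_ to _≤P_)
  open IsPartialOrder isPartialOrder using (antisym; reflexive)
  module L = DeletedCopies lower
  module U = DeletedCopies upper

  -- a point of a layer: taken by element u of copy j (inj₁ (j , u)), or spare (inj₂ j)
  LayerIndex : Set
  LayerIndex = (Fin K × Fin r) ⊎ Fin K

  layer↔ : Vec (Fin h) d ↔ Fin (K * r + K)
  layer↔ = subst (λ N → Vec (Fin h) d ↔ Fin N) (sym layer-size) (grid↔ h d)

  fill-layer : (f : Fin K × Fin r → Vec (Fin h) d) → Injective _≡_ _≡_ f →
               Σ[ g ∈ (LayerIndex → Vec (Fin h) d) ] Injective _≡_ _≡_ g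
  fill-layer f f-inj with spare , inj ← extend-injection (↔-sym *↔×) layer↔ f f-inj = [ f , spare ]′ , inj

  layer : Fin 2 → LayerIndex → Vec (Fin h) d
  layer zero = proj₁ (fill-layer L.embed L.embed-injective)
  layer (suc zero) = proj₁ (fill-layer U.embed U.embed-injective)

  layer-injective : ∀ ℓ → Injective _≡_ _≡_ (layer ℓ)
  layer-injective zero = proj₂ (fill-layer L.embed L.embed-injective)
  layer-injective (suc zero) = proj₂ (fill-layer U.embed U.embed-injective)

  place : Fin 2 × LayerIndex → Stack h d
  place (ℓ , z) = ℓ , layer ℓ z

  place-injective : Injective _≡_ _≡_ place
  place-injective {ℓ , z} eq with refl , same ← ,-injective eq = cong (ℓ ,_) (layer-injective ℓ same)

  -- Copy inj₁ j puts P − M into layer 0 and M into layer 1; copy inj₂ j puts m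
  -- into layer 0 and P − m into layer 1.
  Copy : Set
  Copy = Fin K ⊎ Fin K

  apex : Copy → Fin (suc r)
  apex (inj₁ _) = M
  apex (inj₂ _) = m

  arrange : Copy × (⊤ ⊎ Fin r) → Fin 2 × LayerIndex
  arrange (inj₁ j , inj₁ _) = suc zero , inj₂ j
  arrange (inj₁ j , inj₂ u) = zero , inj₁ (j , u)
  arrange (inj₂ j , inj₁ _) = zero , inj₂ j
  arrange (inj₂ j , inj₂ u) = suc zero , inj₁ (j , u)

  arrange⁻¹ : Fin 2 × LayerIndex → Copy × (⊤ ⊎ Fin r)
  arrange⁻¹ (zero , inj₁ (j , u)) = inj₁ j , inj₂ u
  arrange⁻¹ (zero , inj₂ j) = inj₂ j , inj₁ tt
  arrange⁻¹ (suc zero , inj₁ (j , u)) = inj₂ j , inj₂ u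
  arrange⁻¹ (suc zero , inj₂ j) = inj₁ j , inj₁ tt

  arrange-injective : Injective _≡_ _≡_ arrange
  arrange-injective = retraction⇒injective arrange arrange⁻¹ λ
    { (inj₁ _ , inj₁ _) → refl ; (inj₁ _ , inj₂ _) → refl
    ; (inj₂ _ , inj₁ _) → refl ; (inj₂ _ , inj₂ _) → refl }

  copy : Copy → Fin (suc r) → Stack h d
  copy c p = place (arrange (c , locate (apex c) p))

  copy-injective : Injective _≡_ _≡_ (uncurry copy)
  copy-injective {c , p} {c′ , q} eq
    with refl , same ← ,-injective (arrange-injective {c , locate (apex c) p} {c′ , locate (apex c′) q}
                                       (place-injective eq)) =
    cong (c ,_) (retraction⇒injective (locate (apex c)) (unlocate (apex c)) (unlocate-locate (apex c)) same)

  -- The lower copies are copies of P because M lies above P − M and layer 1 above layer 0.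
  lower-order : ∀ j z z′ → unlocate M z ≤P unlocate M z′ ⇔ place (arrange (inj₁ j , z)) ≤S place (arrange (inj₁ j , z′))
  lower-order j (inj₁ _) (inj₁ _) = mk⇔ (λ _ → inj₂ (refl , λ i → ≤F-refl)) (λ _ → reflexive refl)
  lower-order j (inj₁ _) (inj₂ u) = mk⇔
    (λ M≤ → ⊥-elim (punchInᵢ≢i M u (antisym (M-greatest _) M≤)))
    (λ { (inj₁ (() , _)) ; (inj₂ (() , _)) })
  lower-order j (inj₂ u) (inj₁ _) = mk⇔ (λ _ → inj₁ (refl , refl)) (λ _ → M-greatest _)
  lower-order j (inj₂ u) (inj₂ u′) = mk⇔
    (λ le → inj₂ (refl , Equivalence.to (L.embed-order j u u′) le))
    (λ { (inj₁ (_ , ())) ; (inj₂ (_ , le)) → Equivalence.from (L.embed-order j u u′) le })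

  -- Dually, m lies below P − m and layer 0 below layer 1.
  upper-order : ∀ j z z′ → unlocate m z ≤P unlocate m z′ ⇔ place (arrange (inj₂ j , z)) ≤S place (arrange (inj₂ j , z′))
  upper-order j (inj₁ _) (inj₁ _) = mk⇔ (λ _ → inj₂ (refl , λ i → ≤F-refl)) (λ _ → reflexive refl)
  upper-order j (inj₁ _) (inj₂ u) = mk⇔ (λ _ → inj₁ (refl , refl)) (λ _ → m-least _)
  upper-order j (inj₂ u) (inj₁ _) = mk⇔
    (λ ≤m → ⊥-elim (punchInᵢ≢i m u (antisym ≤m (m-least _))))
    (λ { (inj₁ (() , _)) ; (inj₂ (() , _)) })
  upper-order j (inj₂ u) (inj₂ u′) = mk⇔
    (λ le → inj₂ (refl , Equivalence.to (U.embed-order j u u′) le))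
    (λ { (inj₁ (() , _)) ; (inj₂ (_ , le)) → Equivalence.from (U.embed-order j u u′) le })

  copy-order : ∀ c p q → p ≤P q ⇔ copy c p ≤S copy c q
  copy-order (inj₁ j) = relocate-order M (lower-order j)
  copy-order (inj₂ j) = relocate-order m (upper-order j)

  -- The 2K copies are disjoint, and as 2K·|P| = 2h^d they cover the whole poset.
  partition : PartitionIntoCopies P h d
  partition = K + K , copy ∘ splitAt K , copy-order ∘ splitAt K ,
    injection⇒bijection (↔-sym *↔×) (stack↔ h d) count _ injective
    where
    count : (K + K) * suc r ≡ 2 * h ^ d
    count = trans (double K r) (cong (2 *_) layer-size)
      where
      double : ∀ K r → (K + K) * (1 + r) ≡ 2 * (K * r + K)
      double = solve-∀
    injective : Injective _≡_ _≡_ (uncurry (copy ∘ splitAt K))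
    injective eq with same-copy , same-point ← ,-injective (copy-injective eq) =
      cong₂ _,_ (to-injective +↔⊎ same-copy) same-point

claim2 : (n : ℕ) (P : FinPoset n) → HasMin P → HasMax P →
    (d : ℕ) → HasDimension P d →
    (h : ℕ) → 1 ≤ h → 2 * d * (n * n) ≤ h → n ∣ h →
    PartitionIntoCopies P h d
-- A poset with a minimum is nonempty.
claim2 zero P (() , _) _ _ _ _ _ _ _
-- |P| = 1: the copies are single points, h^d of them in each layer.
claim2 (suc zero) P (m , m-least) (M , M-greatest) d _ h _ _ _ =
  Assembly.partition {K = h ^ d} P m M m-least M-greatest (cong (_+ h ^ d) (*-zeroʳ (h ^ d))) no-deletions no-deletions
claim2 (suc (suc r₀)) P _ _ zero (realizer , _) _ _ _ _
  with () ← zero-dimensional-trivial P realizer zero (suc zero)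
claim2 (suc (suc r₀)) P (m , m-least) (M , M-greatest) (suc e) (realizer , _) h _ big (divides s h≡sn) =
  Assembly.partition P m M m-least M-greatest layer-size (copies-without M) (copies-without m)
  where
  open Room r₀ e s h h≡sn big
  copies-without : ∀ x → DeletedCopies P x copies h (suc e)
  copies-without x = deleted-copies {blocks = blocks} {width = width} P realizer x blocks-fit shifts-fit enough-room
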